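{- Let $k\ge 1$ and $d\ge 1$ be integers. On every $(k,d)$-bounded instance, algorithm GREEDY (with any tie-breaking) obtains value at least $\frac{k}{k+d-1}$ times the optimum offline value, for each of the following three online problems: online maximum (unweighted) bipartite matching, online vertex-weighted bipartite matching, and online equal-bids ad allocation. That is, GREEDY is $\frac{k}{k+d-1}$-competitive for these problems on $(k,d)$-bounded instances.
   Context: Online ad allocation: a bipartite graph $G=(L,R,E)$; each advertiser $i\in L$ has a budget $B_i>0$ and a bid $0<b_{ij}\le B_i$ for each neighbor $j\in N(i)$. Advertisers and budgets are known in advance; ad slots $j\in R$ arrive one at a time together with their incident edges and bids. On arrival, $j$ must be irrevocably allocated to at most one advertiser $i$, which must be feasible, i.e. its residual budget ($B_i$ minus the sum of bids of slots already allocated to it) is at least $b_{ij}$; this yields profit $b_{ij}$. The goal is to maximize total profit. Special cases: equal-bids ($b_{ij}=b_i$ for all $j\in N(i)$); vertex-weighted matching ($b_{ij}=B_i$ for all $j\in N(i)$, so each advertiser is matched at most once and contributes weight $B_i$); maximum matching ($b_{ij}=B_i=1$). GREEDY allocates each arriving ad slot $j$ (if it has a feasible neighbor) to a feasible neighbor $i$ maximizing $b_{ij}$, ties broken arbitrarily. An instance is $(k,d)$-bounded if every ad slot $j\in R$ has degree at most $d$ and every advertiser $i$ satisfies $\sum_{j\in N(i)} b_{ij}\ge k\cdot B_i$ (for the matching problems this means every advertiser has degree at least $k$). An online algorithm is $c$-competitive on a class of instances if on every instance its value is at least $c$ times the optimum offline value.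
   Formalization: The budgets $B_i$ and the bids $b_{ij}$ are rational numbers. -}

module Defs where

open import Data.Nat as ℕ using (ℕ; zero; suc)
open import Data.Integer using (+_)
open import Data.Rational using (ℚ; 0ℚ; 1ℚ; _+_; _*_; _-_; _≤_; _<_; _/_)
open import Data.Fin using (Fin; toℕ) renaming (zero to fz; suc to fs)
open import Data.Fin.Properties using () renaming (_≟_ to _≟F_)
open import Data.Maybe using (Maybe; just; nothing)
open import Data.Bool using (Bool; true; false; T; if_then_else_)
open import Data.Product using (Σ; ∃; _×_)
open import Data.Sum using (_⊎_)
open import Relation.Nullary using (does; ¬_)
open import Relation.Binary.PropositionalEquality using (_≡_)

ℕtoℚ : ℕ → ℚ
ℕtoℚ k = + k / 1

sumℚ : ∀ {m} → (Fin m → ℚ) → ℚ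
sumℚ {zero}  f = 0ℚ
sumℚ {suc m} f = f fz + sumℚ (λ j → f (fs j))

sumℕ : ∀ {m} → (Fin m → ℕ) → ℕ
sumℕ {zero}  f = 0
sumℕ {suc m} f = f fz ℕ.+ sumℕ (λ j → f (fs j))

-- An instance of online ad allocation:
-- advertisers L = Fin n, ad slots R = Fin m arriving in the order 0,1,...,m-1,
-- edge relation E i j (decidable), bids bid i j (meaningful on edges), budgets B i.
record Instance : Set where
  field
    n   : ℕ
    m   : ℕ
    E   : Fin n → Fin m → Bool
    bid : Fin n → Fin m → ℚ
    B   : Fin n → ℚ

module _ (I : Instance) where
  open Instance I

  Edge : Fin n → Fin m → Set
  Edge i j = T (E i j)

  WellFormed : Set
  WellFormed = (∀ i → 0ℚ < B i) × (∀ i j → Edge i j → (0ℚ < bid i j) × (bid i j ≤ B i))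

  EqualBids : Set
  EqualBids = ∀ i j j′ → Edge i j → Edge i j′ → bid i j ≡ bid i j′

  VertexWeighted : Set
  VertexWeighted = ∀ i j → Edge i j → bid i j ≡ B i

  MaxMatching : Set
  MaxMatching = VertexWeighted × (∀ i → B i ≡ 1ℚ)

  degree : Fin m → ℕ
  degree j = sumℕ (λ i → if E i j then 1 else 0)

  Bounded : ℕ → ℕ → Set
  Bounded k d = (∀ j → degree j ℕ.≤ d)
              × (∀ i → ℕtoℚ k * B i ≤ sumℚ (λ j → if E i j then bid i j else 0ℚ))

  Allocation : Set
  Allocation = Fin m → Maybe (Fin n)

  contrib : Allocation → Fin n → Fin m → ℚ
  contrib σ i j′ with σ j′
  ... | nothing = 0ℚ
  ... | just i′ = if does (i′ ≟F i) then bid i j′ else 0ℚ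

  spent : Allocation → Fin n → ℚ
  spent σ i = sumℚ (contrib σ i)

  residual : Allocation → Fin n → Fin m → ℚ
  residual σ i j = B i - sumℚ (λ j′ → if does (toℕ j′ ℕ.<? toℕ j) then contrib σ i j′ else 0ℚ)

  value : Allocation → ℚ
  value σ = sumℚ (λ j → slotValue j (σ j))
    where
    slotValue : Fin m → Maybe (Fin n) → ℚ
    slotValue j nothing  = 0ℚ
    slotValue j (just i) = bid i j

  Feasible : Allocation → Set
  Feasible σ = (∀ j i → σ j ≡ just i → Edge i j) × (∀ i → spent σ i ≤ B i)

  FeasibleFor : Allocation → Fin n → Fin m → Set
  FeasibleFor σ i j = Edge i j × (bid i j ≤ residual σ i j)

  -- σ is a possible run of GREEDY (any tie-breaking)
  IsGreedy : Allocation → Set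
  IsGreedy σ = ∀ j →
      ((σ j ≡ nothing) × (∀ i → ¬ FeasibleFor σ i j))
    ⊎ (∃ λ i → (σ j ≡ just i) × FeasibleFor σ i j
               × (∀ i′ → FeasibleFor σ i′ j → bid i′ j ≤ bid i j))

GreedyCompetitive : ℕ → ℕ → (Instance → Set) → Set
GreedyCompetitive k d P =
  ∀ (I : Instance) → WellFormed I → P I → Bounded I k d →
  ∀ (σ : Allocation I) → IsGreedy I σ →
  ∀ (τ : Allocation I) → Feasible I τ →
  ℕtoℚ k * value I τ ≤ ℕtoℚ (k ℕ.+ d ℕ.∸ 1) * value I σ

{-# OPTIONS --safe #-}
module Submission where

-- Charge OPT to GREEDY advertiser by advertiser: writing OPTᵢ, GREEDYᵢ for the
-- amounts spent on i and pⱼ for GREEDY's profit on slot j, we show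
--   k · OPTᵢ ≤ (k − 1) · GREEDYᵢ + Σ_{j ∈ N(i)} pⱼ.
-- If i was feasible whenever a neighbour j arrived, GREEDY sold j for at least
-- b_ij, so k · OPTᵢ ≤ k B_i ≤ Σ_{j ∈ N(i)} b_ij ≤ Σ_{j ∈ N(i)} pⱼ. Otherwise i was
-- blocked at some neighbour j₀: GREEDY had already spent more than B_i − b on i,
-- b being i's common bid, and since that amount and OPTᵢ ≤ B_i are multiples of b,
-- OPTᵢ ≤ GREEDYᵢ. Summed over i, each pⱼ is counted deg j ≤ d times.

open import Defs
open import Data.Nat as ℕ using (ℕ; zero; suc)
import Data.Nat.Properties as ℕ
import Data.Integer as ℤ
import Data.Integer.Properties as ℤ
open import Data.Rational
open import Data.Rational.Properties
import Data.Rational.Unnormalised as ℚᵘ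
import Data.Rational.Unnormalised.Properties as ℚᵘ
open import Algebra.Bundles using (Ring)
open import Algebra.Properties.Semiring.Sum (Ring.semiring +-*-ring)
  using (sum; sum-cong-≗; sum-replicate-zero; ∑-distrib-+; ∑-comm; *-distribˡ-sum)
open import Algebra.Properties.Group +-0-group using (//-rightDividesˡ)
open import Data.Fin using (Fin; toℕ) renaming (zero to fz; suc to fs)
open import Data.Fin.Properties using (any?) renaming (_≟_ to _≟F_)
open import Data.Bool using (Bool; true; false; T; _∧_; if_then_else_)
open import Data.Maybe using (just; nothing; maybe)
open import Data.Maybe.Properties using (just-injective)
open import Data.Product using (_×_; _,_; proj₁; proj₂)
open import Data.Sum using (inj₁; inj₂)
open import Data.Empty using (⊥-elim)
open import Function using (_∘_)
open import Relation.Nullary using (does; yes; no)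
open import Relation.Nullary.Decidable using (T?; _×-dec_)
open import Relation.Binary.PropositionalEquality

ℕtoℚ-+ : ∀ a b → ℕtoℚ (a ℕ.+ b) ≡ ℕtoℚ a + ℕtoℚ b
ℕtoℚ-+ a b = toℚᵘ-injective (begin-equality
  toℚᵘ (ℕtoℚ (a ℕ.+ b))             ≃⟨ toℚᵘ-fromℚᵘ (ℕtoℚᵘ (a ℕ.+ b)) ⟩
  ℕtoℚᵘ (a ℕ.+ b)                   ≃⟨ ℚᵘ.*≡* (cong (ℤ._* ℤ.+ 1) (sym (cong₂ ℤ._+_ (ℤ.*-identityʳ (ℤ.+ a)) (ℤ.*-identityʳ (ℤ.+ b))))) ⟩
  ℕtoℚᵘ a ℚᵘ.+ ℕtoℚᵘ b              ≃⟨ ℚᵘ.+-cong (toℚᵘ-fromℚᵘ (ℕtoℚᵘ a)) (toℚᵘ-fromℚᵘ (ℕtoℚᵘ b)) ⟨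
  toℚᵘ (ℕtoℚ a) ℚᵘ.+ toℚᵘ (ℕtoℚ b)  ≃⟨ toℚᵘ-homo-+ (ℕtoℚ a) (ℕtoℚ b) ⟨
  toℚᵘ (ℕtoℚ a + ℕtoℚ b)            ∎)
  where
  open ℚᵘ.≤-Reasoning
  ℕtoℚᵘ : ℕ → ℚᵘ.ℚᵘ
  ℕtoℚᵘ n = ℚᵘ.mkℚᵘ (ℤ.+ n) 0

ℕtoℚ-suc-* : ∀ n x → ℕtoℚ (suc n) * x ≡ x + ℕtoℚ n * x
ℕtoℚ-suc-* n x = begin
  ℕtoℚ (suc n) * x        ≡⟨ cong (_* x) (ℕtoℚ-+ 1 n) ⟩
  (1ℚ + ℕtoℚ n) * x       ≡⟨ *-distribʳ-+ x 1ℚ (ℕtoℚ n) ⟩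
  1ℚ * x + ℕtoℚ n * x     ≡⟨ cong (_+ ℕtoℚ n * x) (*-identityˡ x) ⟩
  x + ℕtoℚ n * x          ∎
  where open ≡-Reasoning

ℕtoℚ-nonNeg : ∀ n → 0ℚ ≤ ℕtoℚ n
ℕtoℚ-nonNeg n = nonNegative⁻¹ (ℕtoℚ n) {{normalize-nonNeg n 1}}

ℕtoℚ-*-monoˡ-≤ : ∀ n {x y} → x ≤ y → ℕtoℚ n * x ≤ ℕtoℚ n * y
ℕtoℚ-*-monoˡ-≤ n = *-monoˡ-≤-nonNeg (ℕtoℚ n) {{nonNegative (ℕtoℚ-nonNeg n)}}

ℕtoℚ-mono-≤ : ∀ {a b} → a ℕ.≤ b → ℕtoℚ a ≤ ℕtoℚ b
ℕtoℚ-mono-≤ {b = b} ℕ.z≤n = ℕtoℚ-nonNeg b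
ℕtoℚ-mono-≤ {suc a} {suc b} (ℕ.s≤s a≤b) =
  subst₂ _≤_ (sym (ℕtoℚ-+ 1 a)) (sym (ℕtoℚ-+ 1 b)) (+-monoʳ-≤ 1ℚ (ℕtoℚ-mono-≤ a≤b))

ℕtoℚ-cancel-< : ∀ {a b} → ℕtoℚ a < ℕtoℚ b → a ℕ.< b
ℕtoℚ-cancel-< a<b = ℕ.≰⇒> (λ b≤a → <-irrefl refl (<-≤-trans a<b (ℕtoℚ-mono-≤ b≤a)))

m*b<b+n*b⇒m≤n : ∀ {b m n} → 0ℚ < b → ℕtoℚ m * b < b + ℕtoℚ n * b → m ℕ.≤ n
m*b<b+n*b⇒m≤n {b} {m} {n} b>0 m*b<b+n*b = ℕ.≤-pred (ℕtoℚ-cancel-<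
  (*-cancelʳ-<-nonNeg b {{nonNegative (<⇒≤ b>0)}}
    (subst (ℕtoℚ m * b <_) (sym (ℕtoℚ-suc-* n b)) m*b<b+n*b)))

count : ∀ {m} → (Fin m → Bool) → ℕ
count p = sumℕ (λ j → if p j then 1 else 0)

sumℚ≡sum : ∀ {m} (f : Fin m → ℚ) → sumℚ f ≡ sum f
sumℚ≡sum {zero}  f = refl
sumℚ≡sum {suc m} f = cong (f fz +_) (sumℚ≡sum (f ∘ fs))

sumℚ-cong : ∀ {m} {f g : Fin m → ℚ} → (∀ j → f j ≡ g j) → sumℚ f ≡ sumℚ g
sumℚ-cong {zero}  f≗g = refl
sumℚ-cong {suc m} f≗g = cong₂ _+_ (f≗g fz) (sumℚ-cong (f≗g ∘ fs))

sumℚ-mono-≤ : ∀ {m} {f g : Fin m → ℚ} → (∀ j → f j ≤ g j) → sumℚ f ≤ sumℚ g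
sumℚ-mono-≤ {zero}  f≤g = ≤-refl
sumℚ-mono-≤ {suc m} f≤g = +-mono-≤ (f≤g fz) (sumℚ-mono-≤ (f≤g ∘ fs))

sumℚ-zero : ∀ m → sumℚ {m} (λ _ → 0ℚ) ≡ 0ℚ
sumℚ-zero m = trans (sumℚ≡sum {m} (λ _ → 0ℚ)) (sum-replicate-zero m)

sumℚ-nonNeg : ∀ {m} {f : Fin m → ℚ} → (∀ j → 0ℚ ≤ f j) → 0ℚ ≤ sumℚ f
sumℚ-nonNeg {m} {f} f≥0 = subst (_≤ sumℚ f) (sumℚ-zero m) (sumℚ-mono-≤ f≥0)

sumℚ-distrib-+ : ∀ {m} (f g : Fin m → ℚ) → sumℚ (λ j → f j + g j) ≡ sumℚ f + sumℚ g
sumℚ-distrib-+ f g = begin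
  sumℚ (λ j → f j + g j)  ≡⟨ sumℚ≡sum (λ j → f j + g j) ⟩
  sum (λ j → f j + g j)   ≡⟨ ∑-distrib-+ f g ⟩
  sum f + sum g           ≡⟨ cong₂ _+_ (sumℚ≡sum f) (sumℚ≡sum g) ⟨
  sumℚ f + sumℚ g         ∎
  where open ≡-Reasoning

*-distribˡ-sumℚ : ∀ {m} c (f : Fin m → ℚ) → c * sumℚ f ≡ sumℚ (λ j → c * f j)
*-distribˡ-sumℚ c f = begin
  c * sumℚ f              ≡⟨ cong (c *_) (sumℚ≡sum f) ⟩
  c * sum f               ≡⟨ *-distribˡ-sum c f ⟩
  sum (λ j → c * f j)     ≡⟨ sumℚ≡sum (λ j → c * f j) ⟨
  sumℚ (λ j → c * f j)    ∎
  where open ≡-Reasoning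

sumℚ-comm : ∀ {m n} (f : Fin m → Fin n → ℚ) →
            sumℚ (λ i → sumℚ (f i)) ≡ sumℚ (λ j → sumℚ (λ i → f i j))
sumℚ-comm f = begin
  sumℚ (λ i → sumℚ (f i))              ≡⟨ sumℚ≡sum (λ i → sumℚ (f i)) ⟩
  sum (λ i → sumℚ (f i))               ≡⟨ sum-cong-≗ (λ i → sumℚ≡sum (f i)) ⟩
  sum (λ i → sum (f i))                ≡⟨ ∑-comm f ⟩
  sum (λ j → sum (λ i → f i j))        ≡⟨ sum-cong-≗ (λ j → sumℚ≡sum (λ i → f i j)) ⟨
  sum (λ j → sumℚ (λ i → f i j))       ≡⟨ sumℚ≡sum (λ j → sumℚ (λ i → f i j)) ⟨
  sumℚ (λ j → sumℚ (λ i → f i j))      ∎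
  where open ≡-Reasoning

sumℚ-indicator : ∀ {n} (i′ : Fin n) (x : Fin n → ℚ) →
                 sumℚ (λ i → if does (i′ ≟F i) then x i else 0ℚ) ≡ x i′
sumℚ-indicator {suc n} fz      x = trans (cong (x fz +_) (sumℚ-zero n)) (+-identityʳ (x fz))
sumℚ-indicator {suc n} (fs i′) x = trans (+-identityˡ _) (sumℚ-indicator i′ (x ∘ fs))

sumℚ-if≡count* : ∀ {m} (p : Fin m → Bool) c →
                 sumℚ (λ j → if p j then c else 0ℚ) ≡ ℕtoℚ (count p) * c
sumℚ-if≡count* {zero}  p c = sym (*-zeroˡ c)
sumℚ-if≡count* {suc m} p c with p fz
... | true  = trans (cong (c +_) (sumℚ-if≡count* (p ∘ fs) c)) (sym (ℕtoℚ-suc-* (count (p ∘ fs)) c))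
... | false = trans (+-identityˡ _) (sumℚ-if≡count* (p ∘ fs) c)

if-∧ : ∀ a b {x : ℚ} → (if a then (if b then x else 0ℚ) else 0ℚ) ≡ (if a ∧ b then x else 0ℚ)
if-∧ true  b = refl
if-∧ false b = refl

if-nonNeg : ∀ c {x} → 0ℚ ≤ x → 0ℚ ≤ (if c then x else 0ℚ)
if-nonNeg true  x≥0 = x≥0
if-nonNeg false x≥0 = ≤-refl

if-≤ : ∀ c {x} → 0ℚ ≤ x → (if c then x else 0ℚ) ≤ x
if-≤ true  x≥0 = ≤-refl
if-≤ false x≥0 = x≥0

if-then-mono-≤ : ∀ c {x y z : ℚ} → (T c → x ≤ y) → (if c then x else z) ≤ (if c then y else z)
if-then-mono-≤ true  x≤y = x≤y _
if-then-mono-≤ false x≤y = ≤-refl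

module _ (I : Instance) where
  open Instance I

  AlongEdges : Allocation I → Set
  AlongEdges π = ∀ j i → π j ≡ just i → Edge I i j

  assigned : Allocation I → Fin n → Fin m → Bool
  assigned π i j = maybe (λ i′ → does (i′ ≟F i)) false (π j)

  profit : Allocation I → Fin m → ℚ
  profit π j = maybe (λ i → bid i j) 0ℚ (π j)

  neighbourhoodProfit : Allocation I → Fin n → ℚ
  neighbourhoodProfit π i = sumℚ (λ j → if E i j then profit π j else 0ℚ)

  spentOn : Allocation I → Fin n → (Fin m → Bool) → ℚ
  spentOn π i S = sumℚ (λ j → if S j then contrib I π i j else 0ℚ)

  value≡sum-profit : ∀ π → value I π ≡ sumℚ (profit π)
  value≡sum-profit π = summands
    where
    -- the summand of value is local to its definition, so its type is left to unification
    slot : ∀ j → _ ≡ profit π j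
    summands : value I π ≡ sumℚ (profit π)
    summands = sumℚ-cong slot
    slot j with π j
    ... | nothing = refl
    ... | just i  = refl

  sum-contrib≡profit : ∀ π j → sumℚ (λ i → contrib I π i j) ≡ profit π j
  sum-contrib≡profit π j with π j
  ... | nothing = sumℚ-zero n
  ... | just i′ = sumℚ-indicator i′ (λ i → bid i j)

  value≡sum-spent : ∀ π → value I π ≡ sumℚ (spent I π)
  value≡sum-spent π = begin
    value I π                                  ≡⟨ value≡sum-profit π ⟩
    sumℚ (profit π)                            ≡⟨ sumℚ-cong (sym ∘ sum-contrib≡profit π) ⟩
    sumℚ (λ j → sumℚ (λ i → contrib I π i j))  ≡⟨ sumℚ-comm (λ i j → contrib I π i j) ⟨
    sumℚ (spent I π)                           ∎
    where open ≡-Reasoning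

  module _ (wf : WellFormed I) {π : Allocation I} (along : AlongEdges π) where

    profit-nonNeg : ∀ j → 0ℚ ≤ profit π j
    profit-nonNeg j with π j in πj≡i
    ... | nothing = ≤-refl
    ... | just i  = <⇒≤ (proj₁ (proj₂ wf i j (along j i πj≡i)))

    contrib-nonNeg : ∀ i j → 0ℚ ≤ contrib I π i j
    contrib-nonNeg i j with π j in πj≡i′ | profit-nonNeg j
    ... | nothing | _      = ≤-refl
    ... | just i′ | bid≥0  with i′ ≟F i
    ...   | yes refl = bid≥0
    ...   | no _     = ≤-refl

    contrib≤neighbourProfit : ∀ i j → contrib I π i j ≤ (if E i j then profit π j else 0ℚ)
    contrib≤neighbourProfit i j with π j in πj≡i′ | profit-nonNeg j
    ... | nothing | _     = if-nonNeg (E i j) ≤-refl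
    ... | just i′ | bid≥0 with i′ ≟F i
    ...   | no _     = if-nonNeg (E i j) bid≥0
    ...   | yes refl with E i j | along j i′ πj≡i′
    ...     | true | _ = ≤-refl

    spent≤neighbourhoodProfit : ∀ i → spent I π i ≤ neighbourhoodProfit π i
    spent≤neighbourhoodProfit i = sumℚ-mono-≤ (contrib≤neighbourProfit i)

    spentOn≤spent : ∀ i S → spentOn π i S ≤ spent I π i
    spentOn≤spent i S = sumℚ-mono-≤ (λ j → if-≤ (S j) (contrib-nonNeg i j))

    sum-neighbourhoodProfit≤ : ∀ {d} → (∀ j → degree I j ℕ.≤ d) →
                               sumℚ (neighbourhoodProfit π) ≤ ℕtoℚ d * value I π
    sum-neighbourhoodProfit≤ {d} degree≤d = begin
      sumℚ (neighbourhoodProfit π)                   ≡⟨ sumℚ-comm (λ i j → if E i j then profit π j else 0ℚ) ⟩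
      sumℚ (λ j → sumℚ (λ i → if E i j then profit π j else 0ℚ))
                                                     ≡⟨ sumℚ-cong (λ j → sumℚ-if≡count* (λ i → E i j) (profit π j)) ⟩
      sumℚ (λ j → ℕtoℚ (degree I j) * profit π j)    ≤⟨ sumℚ-mono-≤ (λ j →
                                                          *-monoʳ-≤-nonNeg (profit π j) {{nonNegative (profit-nonNeg j)}}
                                                            (ℕtoℚ-mono-≤ (degree≤d j))) ⟩
      sumℚ (λ j → ℕtoℚ d * profit π j)               ≡⟨ *-distribˡ-sumℚ (ℕtoℚ d) (profit π) ⟨
      ℕtoℚ d * sumℚ (profit π)                       ≡⟨ cong (ℕtoℚ d *_) (value≡sum-profit π) ⟨
      ℕtoℚ d * value I π                             ∎
      where open ≤-Reasoning

  module _ (equalBids : EqualBids I) {π : Allocation I} (along : AlongEdges π)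
           {i j₀} (e₀ : Edge I i j₀) where

    contrib-equalBids : ∀ j → contrib I π i j ≡ (if assigned π i j then bid i j₀ else 0ℚ)
    contrib-equalBids j with π j in πj≡i′
    ... | nothing = refl
    ... | just i′ with i′ ≟F i
    ...   | yes refl = equalBids i j j₀ (along j i πj≡i′) e₀
    ...   | no _     = refl

    spentOn-equalBids : ∀ S → spentOn π i S ≡ ℕtoℚ (count (λ j → S j ∧ assigned π i j)) * bid i j₀
    spentOn-equalBids S = trans
      (sumℚ-cong (λ j → trans (cong (λ x → if S j then x else 0ℚ) (contrib-equalBids j))
                              (if-∧ (S j) (assigned π i j))))
      (sumℚ-if≡count* (λ j → S j ∧ assigned π i j) (bid i j₀))

  blocked⇒spent≤ : WellFormed I → EqualBids I → ∀ {σ τ} → AlongEdges σ → Feasible I τ →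
                   ∀ {i j₀} → Edge I i j₀ → residual I σ i j₀ < bid i j₀ →
                   spent I τ i ≤ spent I σ i
  blocked⇒spent≤ wf equalBids {σ} {τ} σ-along (τ-along , τ-budget) {i} {j₀} e₀ blocked = begin
    spent I τ i              ≡⟨ spentOn-equalBids equalBids τ-along e₀ (λ _ → true) ⟩
    ℕtoℚ #τ * b              ≤⟨ *-monoʳ-≤-nonNeg b {{nonNegative (<⇒≤ b>0)}} (ℕtoℚ-mono-≤ #τ≤#σ) ⟩
    ℕtoℚ #σ * b              ≡⟨ spentOn-equalBids equalBids σ-along e₀ before ⟨
    spentOn σ i before       ≤⟨ spentOn≤spent wf σ-along i before ⟩
    spent I σ i              ∎
    where
    open ≤-Reasoning
    b : ℚ
    b = bid i j₀
    b>0 : 0ℚ < b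
    b>0 = proj₁ (proj₂ wf i j₀ e₀)
    before : Fin m → Bool
    before j = does (toℕ j ℕ.<? toℕ j₀)
    #τ #σ : ℕ
    #τ = count (assigned τ i)
    #σ = count (λ j → before j ∧ assigned σ i j)
    #τ≤#σ : #τ ℕ.≤ #σ
    #τ≤#σ = m*b<b+n*b⇒m≤n b>0 (begin-strict
      ℕtoℚ #τ * b                 ≡⟨ spentOn-equalBids equalBids τ-along e₀ (λ _ → true) ⟨
      spent I τ i                 ≤⟨ τ-budget i ⟩
      B i                         ≡⟨ //-rightDividesˡ (spentOn σ i before) (B i) ⟨
      residual I σ i j₀ + spentOn σ i before  <⟨ +-monoˡ-< (spentOn σ i before) blocked ⟩
      b + spentOn σ i before      ≡⟨ cong (b +_) (spentOn-equalBids equalBids σ-along e₀ before) ⟩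
      b + ℕtoℚ #σ * b             ∎)

  module _ {σ : Allocation I} (greedy : IsGreedy I σ) where

    greedy-alongEdges : AlongEdges σ
    greedy-alongEdges j i σj≡i with greedy j
    ... | inj₁ (σj≡nothing , _) with () ← trans (sym σj≡nothing) σj≡i
    ... | inj₂ (i′ , σj≡i′ , (e , _) , _) with refl ← just-injective (trans (sym σj≡i′) σj≡i) = e

    greedy-bid≤profit : ∀ {i j} → FeasibleFor I σ i j → bid i j ≤ profit σ j
    greedy-bid≤profit {i} {j} feasible with greedy j
    ... | inj₁ (_ , infeasible)          = ⊥-elim (infeasible i feasible)
    ... | inj₂ (i′ , σj≡i′ , _ , isBest) rewrite σj≡i′ = isBest i feasible

    never-blocked⇒≤neighbourhoodProfit : ∀ {i} → (∀ j → Edge I i j → bid i j ≤ residual I σ i j) →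
      sumℚ (λ j → if E i j then bid i j else 0ℚ) ≤ neighbourhoodProfit σ i
    never-blocked⇒≤neighbourhoodProfit {i} unblocked =
      sumℚ-mono-≤ (λ j → if-then-mono-≤ (E i j) (λ e → greedy-bid≤profit (e , unblocked j e)))

    advertiser-bound : WellFormed I → EqualBids I → ∀ {k τ} → Feasible I τ → ∀ {i} →
                       ℕtoℚ (suc k) * B i ≤ sumℚ (λ j → if E i j then bid i j else 0ℚ) →
                       ℕtoℚ (suc k) * spent I τ i ≤ ℕtoℚ k * spent I σ i + neighbourhoodProfit σ i
    advertiser-bound wf equalBids {k} {τ} feasible {i} kB≤bids
      with any? (λ j → T? (E i j) ×-dec (residual I σ i j <? bid i j))
    ... | yes (j₀ , e₀ , blocked) = begin
      ℕtoℚ (suc k) * spent I τ i                     ≤⟨ ℕtoℚ-*-monoˡ-≤ (suc k)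
                                                          (blocked⇒spent≤ wf equalBids greedy-alongEdges feasible e₀ blocked) ⟩
      ℕtoℚ (suc k) * spent I σ i                     ≡⟨ ℕtoℚ-suc-* k (spent I σ i) ⟩
      spent I σ i + ℕtoℚ k * spent I σ i             ≤⟨ +-monoˡ-≤ (ℕtoℚ k * spent I σ i)
                                                          (spent≤neighbourhoodProfit wf greedy-alongEdges i) ⟩
      neighbourhoodProfit σ i + ℕtoℚ k * spent I σ i ≡⟨ +-comm (neighbourhoodProfit σ i) (ℕtoℚ k * spent I σ i) ⟩
      ℕtoℚ k * spent I σ i + neighbourhoodProfit σ i ∎
      where open ≤-Reasoning
    ... | no neverBlocked = begin
      ℕtoℚ (suc k) * spent I τ i                     ≤⟨ ℕtoℚ-*-monoˡ-≤ (suc k) (proj₂ feasible i) ⟩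
      ℕtoℚ (suc k) * B i                             ≤⟨ kB≤bids ⟩
      sumℚ (λ j → if E i j then bid i j else 0ℚ)     ≤⟨ never-blocked⇒≤neighbourhoodProfit
                                                          (λ j e → ≮⇒≥ (λ blocked → neverBlocked (j , e , blocked))) ⟩
      neighbourhoodProfit σ i                        ≡⟨ +-identityˡ (neighbourhoodProfit σ i) ⟨
      0ℚ + neighbourhoodProfit σ i                   ≤⟨ +-monoˡ-≤ (neighbourhoodProfit σ i) k*spent≥0 ⟩
      ℕtoℚ k * spent I σ i + neighbourhoodProfit σ i ∎
      where
      open ≤-Reasoning
      k*spent≥0 : 0ℚ ≤ ℕtoℚ k * spent I σ i
      k*spent≥0 = subst (_≤ ℕtoℚ k * spent I σ i) (*-zeroʳ (ℕtoℚ k))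
                    (ℕtoℚ-*-monoˡ-≤ k (sumℚ-nonNeg (contrib-nonNeg wf greedy-alongEdges i)))

greedy-competitive-equalBids : ∀ k d → GreedyCompetitive (suc k) d EqualBids
greedy-competitive-equalBids k d I wf equalBids bounded σ greedy τ feasible = begin
  ℕtoℚ (suc k) * value I τ                                    ≡⟨ cong (ℕtoℚ (suc k) *_) (value≡sum-spent I τ) ⟩
  ℕtoℚ (suc k) * sumℚ (spent I τ)                             ≡⟨ *-distribˡ-sumℚ (ℕtoℚ (suc k)) (spent I τ) ⟩
  sumℚ (λ i → ℕtoℚ (suc k) * spent I τ i)                     ≤⟨ sumℚ-mono-≤ (λ i → advertiser-bound I greedy wf equalBids {k} feasible (proj₂ bounded i)) ⟩
  sumℚ (λ i → ℕtoℚ k * spent I σ i + neighbourhoodProfit I σ i) ≡⟨ sumℚ-distrib-+ _ (neighbourhoodProfit I σ) ⟩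
  sumℚ (λ i → ℕtoℚ k * spent I σ i) + sumℚ (neighbourhoodProfit I σ)
                                                              ≤⟨ +-mono-≤ (≤-reflexive greedyPart)
                                                                   (sum-neighbourhoodProfit≤ I wf (greedy-alongEdges I greedy) (proj₁ bounded)) ⟩
  ℕtoℚ k * value I σ + ℕtoℚ d * value I σ                     ≡⟨ *-distribʳ-+ (value I σ) (ℕtoℚ k) (ℕtoℚ d) ⟨
  (ℕtoℚ k + ℕtoℚ d) * value I σ                               ≡⟨ cong (_* value I σ) (ℕtoℚ-+ k d) ⟨
  ℕtoℚ (k ℕ.+ d) * value I σ                                  ∎
  where
  open ≤-Reasoning
  greedyPart : sumℚ (λ i → ℕtoℚ k * spent I σ i) ≡ ℕtoℚ k * value I σ
  greedyPart = trans (sym (*-distribˡ-sumℚ (ℕtoℚ k) (spent I σ))) (cong (ℕtoℚ k *_) (sym (value≡sum-spent I σ)))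

greedyCompetitive-anti-mono : ∀ {k d} {P Q : Instance → Set} → (∀ I → P I → Q I) →
                              GreedyCompetitive k d Q → GreedyCompetitive k d P
greedyCompetitive-anti-mono P⇒Q competitive I wf = competitive I wf ∘ P⇒Q I

vertexWeighted⇒equalBids : ∀ I → VertexWeighted I → EqualBids I
vertexWeighted⇒equalBids I vw i j j′ e e′ = trans (vw i j e) (sym (vw i j′ e′))

mainTheorem1 : (k d : ℕ) → 1 ℕ.≤ k → 1 ℕ.≤ d →
    GreedyCompetitive k d MaxMatching
    × GreedyCompetitive k d VertexWeighted
    × GreedyCompetitive k d EqualBids
mainTheorem1 (suc k) d _ _ =
    greedyCompetitive-anti-mono {suc k} (λ I → vertexWeighted⇒equalBids I ∘ proj₁) equalBids
  , greedyCompetitive-anti-mono {suc k} vertexWeighted⇒equalBids equalBids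
  , equalBids
  where
  equalBids : GreedyCompetitive (suc k) d EqualBids
  equalBids = greedy-competitive-equalBids k d
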